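{- Let $D$ be an oriented graph whose arc set admits two distinct partitions $(R,B)$ and $(R',B')$ into red and blue arcs such that for every vertex $v$, $\deg^+_R(v)=\deg^+_{R'}(v)$, $\deg^-_R(v)=\deg^-_{R'}(v)$, $\deg^+_B(v)=\deg^+_{B'}(v)$ and $\deg^-_B(v)=\deg^-_{B'}(v)$. Then $D$ contains an alternating closed trail.
   Context: $\deg^+_X(v)$ and $\deg^-_X(v)$ denote the out- and in-degree of $v$ in the oriented graph with arc set $X$. An alternating closed trail in an oriented graph is a cyclic sequence of distinct arcs $e_0,e_1,\dots,e_{2m}=e_0$ such that (indices mod $2m$) for each $i$ the arcs $e_i$ and $e_{i+1}$ share a vertex $v_i$ and are both directed into $v_i$ or both out of $v_i$, and $v_i\neq v_{i+1}$ for each $i$ (non-consecutive $v_i,v_j$ may coincide). -}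

module Defs where

open import Data.Nat using (ℕ; zero; suc; _*_)
open import Data.Nat.DivMod using (_%_; m%n<n)
open import Data.Fin using (Fin; toℕ; fromℕ<)
open import Data.Fin.Properties using (_≟_)
open import Data.Bool using (Bool; true; false)
import Data.Bool.Properties as BP
open import Data.List using (List; filter; length; allFin)
open import Data.Product using (Σ; _×_; _,_; proj₁; proj₂; ∃)
open import Data.Sum using (_⊎_)
open import Data.Empty using (⊥)
open import Relation.Nullary using (¬_)
open import Relation.Nullary.Decidable using (_×-dec_)
open import Relation.Binary.PropositionalEquality using (_≡_; _≢_)
open import Function.Definitions using (Injective)

Arc : ℕ → Set
Arc n = Fin n × Fin n

tail head : ∀ {n} → Arc n → Fin n
tail = proj₁
head = proj₂

record IsOriented {n m : ℕ} (A : Fin m → Arc n) : Set where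
  field
    noLoop     : ∀ i → tail (A i) ≢ head (A i)
    noParallel : ∀ i j → A i ≡ A j → i ≡ j
    noOpposite : ∀ i j → tail (A i) ≡ head (A j) → head (A i) ≡ tail (A j) → ⊥

-- A red/blue partition of the arc set: colour true = red, false = blue.
Colouring : ℕ → Set
Colouring m = Fin m → Bool

outdeg : ∀ {n m} → (Fin m → Arc n) → Colouring m → Bool → Fin n → ℕ
outdeg A col b v =
  length (filter (λ i → (col i BP.≟ b) ×-dec (tail (A i) ≟ v)) (allFin _))

indeg : ∀ {n m} → (Fin m → Arc n) → Colouring m → Bool → Fin n → ℕ
indeg A col b v =
  length (filter (λ i → (col i BP.≟ b) ×-dec (head (A i) ≟ v)) (allFin _))

next : ∀ {k} → Fin k → Fin k
next {suc k} i = fromℕ< (m%n<n (suc (toℕ i)) (suc k))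

SameDirAt : ∀ {n} → Arc n → Arc n → Fin n → Set
SameDirAt a b v = (head a ≡ v × head b ≡ v) ⊎ (tail a ≡ v × tail b ≡ v)

-- An alternating closed trail of length 2(t+1): distinct arcs e_0,…,e_{2t+1}
-- (cyclically), with vertices v_i, such that e_i, e_{i+1} are both into or
-- both out of v_i, and v_i ≠ v_{i+1} (indices mod 2(t+1)).
record AltClosedTrail {n m : ℕ} (A : Fin m → Arc n) (t : ℕ) : Set where
  field
    e   : Fin (2 * suc t) → Fin m
    vs  : Fin (2 * suc t) → Fin n
    distinct : Injective _≡_ _≡_ e
    share    : ∀ i → SameDirAt (A (e i)) (A (e (next i))) (vs i)
    vdiff    : ∀ i → vs i ≢ vs (next i)

HasAltClosedTrail : ∀ {n m} → (Fin m → Arc n) → Set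
HasAltClosedTrail A = ∃ λ t → AltClosedTrail A t

{-# OPTIONS --safe #-}
-- Call an arc changed if its colour differs in the two partitions. If x is red in (R,B) and
-- blue in (R',B'), then head x has the same red in-degree in both partitions, so some arc y
-- into head x is blue in (R,B) and red in (R',B'); symmetrically, an arc turning from blue to
-- red has such a partner out of its tail. Following partners from a changed arc alternates the
-- colour, hence also whether consecutive arcs meet at a head or at a tail. The first repetition
-- of this walk closes a cycle of distinct arcs, of even length because colours alternate, and
-- it is an alternating closed trail: consecutive turning vertices are the head and the tail of
-- one arc, which differ since D has no loops.
module Submission where

open import Defs
open import Data.Nat using (ℕ; zero; suc; _+_; _*_; _∸_; _<_; _≤_; _%_; s≤s⁻¹)
open import Data.Nat.Properties
  using (<⇒≤; <⇒≢; <-irrefl; ≤-reflexive; n<1+n; m<1+n⇒m<n∨m≡n; m≤n⇒m<n∨m≡n;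
         +-cancelʳ-≡; +-monoˡ-<; *-suc; m∸n+n≡m)
open import Data.Nat.DivMod using (m<n⇒m%n≡m; n%n≡0)
open import Data.Fin using (Fin; toℕ; fromℕ<)
open import Data.Fin.Properties using (toℕ<n; toℕ-fromℕ<; toℕ-injective; any?; pigeonhole)
  renaming (_≟_ to _≟ᶠ_)
open import Data.Bool using (Bool; true; false; not)
open import Data.Bool.Properties using (not-¬; ¬-not; not-involutive) renaming (_≟_ to _≟ᵇ_)
open import Data.List using (_∷_; filter; length; allFin)
open import Data.List.Relation.Unary.Any using (Any; here; there; satisfied)
open import Data.List.Membership.Propositional using (lose)
open import Data.List.Membership.Propositional.Properties using (∈-allFin)
open import Data.Product using (∃; ∃₂; _×_; _,_; proj₁; proj₂)
open import Data.Sum using (_⊎_; inj₁; inj₂)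
open import Data.Empty using (⊥-elim)
open import Function using (_∘_)
open import Function.Definitions using (Injective)
open import Relation.Nullary using (yes; no)
open import Relation.Nullary.Decidable using (_×-dec_)
open import Relation.Unary using (Pred; Decidable; _∖_)
open import Relation.Binary.PropositionalEquality
  using (_≡_; _≢_; refl; sym; trans; cong; subst; module ≡-Reasoning)

module _ {a p q} {X : Set a} {P : Pred X p} {Q : Pred X q}
         (P? : Decidable P) (Q? : Decidable Q) where

  filter-<⇒Any-∖ : ∀ xs → length (filter P? xs) < length (filter Q? xs) → Any (Q ∖ P) xs
  filter-<⇒Any-∖ (x ∷ xs) lt with P? x | Q? x
  ... | yes _  | yes _ = there (filter-<⇒Any-∖ xs (s≤s⁻¹ lt))
  ... | yes _  | no _  = there (filter-<⇒Any-∖ xs (<⇒≤ lt))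
  ... | no ¬px | yes qx = here (qx , ¬px)
  ... | no _   | no _  = there (filter-<⇒Any-∖ xs lt)

  filter-≤⇒Any-∖ : ∀ {xs} → Any (P ∖ Q) xs →
                   length (filter P? xs) ≤ length (filter Q? xs) → Any (Q ∖ P) xs
  filter-≤⇒Any-∖ {x ∷ xs} (here (px , ¬qx)) le with P? x | Q? x
  ... | yes _  | yes qx = ⊥-elim (¬qx qx)
  ... | yes _  | no _   = there (filter-<⇒Any-∖ xs le)
  ... | no ¬px | _      = ⊥-elim (¬px px)
  filter-≤⇒Any-∖ {x ∷ xs} (there any) le with P? x | Q? x
  ... | yes _  | yes _  = there (filter-≤⇒Any-∖ any (s≤s⁻¹ le))
  ... | yes _  | no _   = there (filter-<⇒Any-∖ xs le)
  ... | no ¬px | yes qx = here (qx , ¬px)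
  ... | no _   | no _   = there (filter-≤⇒Any-∖ any le)

module _ {m} (s : ℕ → Fin m) where

  InjectiveBelow : ℕ → Set
  InjectiveBelow k = ∀ {i j} → i < k → j < k → s i ≡ s j → i ≡ j

  injectiveBelow-or-repeat : ∀ k →
    InjectiveBelow k ⊎ ∃₂ λ i j → i < j × s i ≡ s j × InjectiveBelow j
  injectiveBelow-or-repeat zero = inj₁ λ ()
  injectiveBelow-or-repeat (suc k) with injectiveBelow-or-repeat k
  ... | inj₂ repeat = inj₂ repeat
  ... | inj₁ injective with any? (λ (i : Fin k) → s (toℕ i) ≟ᶠ s k)
  ...   | yes (i , si≡sk) = inj₂ (toℕ i , k , toℕ<n i , si≡sk , injective)
  ...   | no unseen = inj₁ extended
    where
    fresh : ∀ {i} → i < k → s i ≢ s k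
    fresh i<k eq = unseen (fromℕ< i<k , trans (cong s (toℕ-fromℕ< i<k)) eq)

    extended : InjectiveBelow (suc k)
    extended i<1+k j<1+k eq with m<1+n⇒m<n∨m≡n i<1+k | m<1+n⇒m<n∨m≡n j<1+k
    ... | inj₁ i<k  | inj₁ j<k  = injective i<k j<k eq
    ... | inj₁ i<k  | inj₂ refl = ⊥-elim (fresh i<k eq)
    ... | inj₂ refl | inj₁ j<k  = ⊥-elim (fresh j<k (sym eq))
    ... | inj₂ refl | inj₂ refl = refl

  first-repeat : ∃₂ λ i j → i < j × s i ≡ s j × InjectiveBelow j
  first-repeat with injectiveBelow-or-repeat (suc m)
  ... | inj₂ repeat = repeat
  ... | inj₁ injective with pigeonhole (n<1+n m) (s ∘ toℕ)
  ...   | i , j , i<j , eq = ⊥-elim (<⇒≢ i<j (injective (toℕ<n i) (toℕ<n j) eq))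

module _ (b : ℕ → Bool) (alternates : ∀ k → b (suc k) ≡ not (b k)) where

  alternating-gap-even : ∀ i d → b (d + i) ≡ b i → ∃ λ t → d ≡ 2 * t
  alternating-gap-even i zero          _  = 0 , refl
  alternating-gap-even i (suc zero)    eq = ⊥-elim (not-¬ refl (trans (sym eq) (alternates i)))
  alternating-gap-even i (suc (suc d)) eq with alternating-gap-even i d (trans (sym two-steps) eq)
    where
    two-steps : b (2 + d + i) ≡ b (d + i)
    two-steps = trans (alternates _) (trans (cong not (alternates _)) (not-involutive _))
  ... | t , d≡2t = suc t , trans (cong (2 +_) d≡2t) (sym (*-suc 2 t))

toℕ-next : ∀ {k} (a : Fin (suc k)) →
           toℕ (next a) ≡ suc (toℕ a) ⊎ (toℕ (next a) ≡ 0 × suc (toℕ a) ≡ suc k)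
toℕ-next {k} a with m≤n⇒m<n∨m≡n (toℕ<n a)
... | inj₁ lt   = inj₁ (trans (toℕ-fromℕ< _) (m<n⇒m%n≡m lt))
... | inj₂ last =
  inj₂ (trans (toℕ-fromℕ< _) (trans (cong (_% suc k) last) (n%n≡0 (suc k))) , last)

module Orbit {m} (g : Fin m → Fin m) (x : Fin m) where

  orbit : ℕ → Fin m
  orbit zero    = x
  orbit (suc k) = g (orbit k)

  module _ {d i} (closes : orbit (suc d + i) ≡ orbit i)
               (injective : InjectiveBelow orbit (suc d + i)) where

    cycle : Fin (suc d) → Fin m
    cycle a = orbit (toℕ a + i)

    cycle-injective : Injective _≡_ _≡_ cycle
    cycle-injective {a} {b} eq =
      toℕ-injective (+-cancelʳ-≡ i _ _
        (injective (+-monoˡ-< i (toℕ<n a)) (+-monoˡ-< i (toℕ<n b)) eq))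

    cycle-next : ∀ a → cycle (next a) ≡ g (cycle a)
    cycle-next a with toℕ-next a
    ... | inj₁ step = cong (λ k → orbit (k + i)) step
    ... | inj₂ (wraps , last) = begin
      orbit (toℕ (next a) + i) ≡⟨ cong (λ k → orbit (k + i)) wraps ⟩
      orbit i                  ≡⟨ closes ⟨
      orbit (suc d + i)        ≡⟨ cong (λ k → orbit (k + i)) last ⟨
      g (cycle a)              ∎
      where open ≡-Reasoning

module _ {n m} (A : Fin m → Arc n) where

  end : Bool → Arc n → Fin n
  end true  = head
  end false = tail

  end-not-≢ : ∀ b {a} → tail a ≢ head a → end b a ≢ end (not b) a
  end-not-≢ true  noLoop = noLoop ∘ sym
  end-not-≢ false noLoop = noLoop

  -- redDegree col true is indeg A col true and redDegree col false is outdeg A col true.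
  redDegree : Colouring m → Bool → Fin n → ℕ
  redDegree col b v =
    length (filter (λ i → (col i ≟ᵇ true) ×-dec (end b (A i) ≟ᶠ v)) (allFin m))

  exchange-partner : ∀ {c₁ c₂ : Colouring m} b {x} →
    redDegree c₁ b (end b (A x)) ≤ redDegree c₂ b (end b (A x)) →
    c₁ x ≡ true → c₂ x ≡ false →
    ∃ λ y → c₁ y ≡ false × c₂ y ≡ true × end b (A y) ≡ end b (A x)
  exchange-partner b {x} le c₁x c₂x
    with y , (c₂y , meet) , ¬red₁ ← satisfied (filter-≤⇒Any-∖ _ _
           (lose (∈-allFin x) ((c₁x , refl) , not-¬ c₂x ∘ proj₁)) le)
    = y , ¬-not (λ c₁y → ¬red₁ (c₁y , meet)) , c₂y , meet

  module _ (oriented : IsOriented A) (c c' : Colouring m)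
           (same-red-degree : ∀ b v → redDegree c b v ≡ redDegree c' b v) where

    open IsOriented oriented

    Changed : Fin m → Set
    Changed x = c' x ≡ not (c x)

    Linked : Fin m → Fin m → Set
    Linked x y = c y ≡ not (c x) × c' y ≡ c x × end (c x) (A y) ≡ end (c x) (A x)

    linked⇒changed : ∀ {x y} → Linked x y → Changed y
    linked⇒changed {x} (cy , c'y , _) =
      trans c'y (trans (sym (not-involutive (c x))) (cong not (sym cy)))

    linked⇒SameDirAt : ∀ {x y} → Linked x y → SameDirAt (A x) (A y) (end (c x) (A x))
    linked⇒SameDirAt {x} (_ , _ , meet) with c x
    ... | true  = inj₁ (refl , meet)
    ... | false = inj₂ (refl , meet)

    linked⇒ends-≢ : ∀ {x y} → Linked x y → end (c x) (A x) ≢ end (c y) (A y)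
    linked⇒ends-≢ {x} {y} (cy , _ , meet) eq =
      end-not-≢ (c x) (noLoop y) (trans meet (trans eq (cong (λ b → end b (A y)) cy)))

    linked-cycle⇒trail : ∀ {t} (e : Fin (2 * suc t) → Fin m) → Injective _≡_ _≡_ e →
                         (∀ a → Linked (e a) (e (next a))) → AltClosedTrail A t
    linked-cycle⇒trail e injective linked = record
      { e        = e
      ; vs       = λ a → end (c (e a)) (A (e a))
      ; distinct = injective
      ; share    = linked⇒SameDirAt ∘ linked
      ; vdiff    = linked⇒ends-≢ ∘ linked
      }

    partner : ∀ x → Changed x → ∃ (Linked x)
    partner x = partnerOf (c x) refl
      where
      partnerOf : ∀ b → c x ≡ b → c' x ≡ not b →
                  ∃ λ y → c y ≡ not b × c' y ≡ b × end b (A y) ≡ end b (A x)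
      partnerOf true  cx c'x = exchange-partner true (≤-reflexive (same-red-degree true _)) cx c'x
      partnerOf false cx c'x
        with y , c'y , cy , meet ←
               exchange-partner false (≤-reflexive (sym (same-red-degree false _))) c'x cx
        = y , cy , c'y , meet

    successor : Fin m → Fin m
    successor x with c' x ≟ᵇ not (c x)
    ... | yes changed = proj₁ (partner x changed)
    ... | no _        = x

    successor-linked : ∀ {x} → Changed x → Linked x (successor x)
    successor-linked {x} changed with c' x ≟ᵇ not (c x)
    ... | yes changed′ = proj₂ (partner x changed′)
    ... | no unchanged = ⊥-elim (unchanged changed)

    module _ (x : Fin m) (changed : Changed x) where
      open Orbit successor x

      changed-orbit : ∀ k → Changed (orbit k)
      changed-orbit zero    = changed
      changed-orbit (suc k) = linked⇒changed (successor-linked (changed-orbit k))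

      linked-orbit : ∀ k → Linked (orbit k) (orbit (suc k))
      linked-orbit k = successor-linked (changed-orbit k)

      changed⇒trail : HasAltClosedTrail A
      changed⇒trail with first-repeat orbit
      ... | i , j , i<j , repeats , injective with j ∸ i | m∸n+n≡m (<⇒≤ i<j)
      ... | d | refl
        with alternating-gap-even (c ∘ orbit) (proj₁ ∘ linked-orbit) i d (cong c (sym repeats))
      ... | zero  , refl = ⊥-elim (<-irrefl refl i<j)
      ... | suc t , refl =
        t , linked-cycle⇒trail (cycle closes injective) (cycle-injective closes injective) linked-cycle
        where
        closes : orbit (2 * suc t + i) ≡ orbit i
        closes = sym repeats

        linked-cycle : ∀ a → Linked (cycle closes injective a) (cycle closes injective (next a))
        linked-cycle a =
          subst (Linked _) (sym (cycle-next closes injective a)) (linked-orbit (toℕ a + i))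

lemma2p2 : (n m : ℕ) (A : Fin m → Arc n) → IsOriented A →
    (c c' : Colouring m) → (∃ λ i → c i ≢ c' i) →
    (∀ v → outdeg A c true v ≡ outdeg A c' true v) →
    (∀ v → indeg A c true v ≡ indeg A c' true v) →
    (∀ v → outdeg A c false v ≡ outdeg A c' false v) →
    (∀ v → indeg A c false v ≡ indeg A c' false v) →
    HasAltClosedTrail A
lemma2p2 n m A oriented c c' (x , cx≢c'x) same-red-out same-red-in _ _ =
  changed⇒trail A oriented c c' same-red-degree x (¬-not (cx≢c'x ∘ sym))
  where
  same-red-degree : ∀ b v → redDegree A c b v ≡ redDegree A c' b v
  same-red-degree true  = same-red-in
  same-red-degree false = same-red-out
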